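{- For every sequence $(s_k)_{k\ge1}$ of positive integers, the set $\mathcal{L}^{(s_k)}\subseteq\{0,1\}^*$ is well-quasi-ordered under the factor order, i.e. it contains no infinite antichain with respect to the relation "$u$ is a factor of $w$".
   Context: For a binary word $\gamma=\gamma_1\cdots\gamma_n$, its complement is $\overline{\gamma}=(1-\gamma_1)\cdots(1-\gamma_n)$. A factor of a word $w$ is a contiguous subword, i.e. $u$ is a factor of $w$ if $w=w_1uw_2$ for possibly empty words $w_1,w_2$; the factor order is the partial order $u\le w$ iff $u$ is a factor of $w$. Given a sequence $(s_k)_{k\ge1}$ of positive integers, define binary words $\alpha^{(s_k)}_1=01$ and, for $i\ge1$, $\alpha^{(s_k)}_{i+1}=(\alpha^{(s_k)}_i)^{s_i}(\overline{\alpha}^{(s_k)}_i)^{s_i}$. Let $\mathcal{L}^{(s_k)}$ be the set of all words (including the empty word) that are factors of $\alpha^{(s_k)}_i$ for some $i\ge1$. -}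

module Defs where

open import Data.Bool using (Bool; true; false; not)
open import Data.Nat using (ℕ; zero; suc; _≤_)
open import Data.List using (List; []; _∷_; _++_; map; concat; replicate)
open import Data.Product using (Σ; ∃; _×_)
open import Relation.Binary.PropositionalEquality using (_≡_; _≢_)
open import Relation.Nullary using (¬_)

-- Binary words: lists of Bool, with false = 0 and true = 1.
Word : Set
Word = List Bool

complement : Word → Word
complement = map not

power : Word → ℕ → Word
power w n = concat (replicate n w)

Factor : Word → Word → Set
Factor u w = ∃ λ w₁ → ∃ λ w₂ → w ≡ w₁ ++ u ++ w₂

-- Sequences are indexed from 0: s k here is s_{k+1} of the paper,
-- and alpha s i here is α_{i+1}^{(s_k)} of the paper.
alpha : (ℕ → ℕ) → ℕ → Word
alpha s zero    = false ∷ true ∷ []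
alpha s (suc i) = power (alpha s i) (s i) ++ power (complement (alpha s i)) (s i)

InL : (ℕ → ℕ) → Word → Set
InL s u = ∃ λ i → Factor u (alpha s i)

InfiniteAntichain : (ℕ → ℕ) → Set
InfiniteAntichain s =
  Σ (ℕ → Word) λ f →
    ((n : ℕ) → InL s (f n)) ×
    ((m n : ℕ) → m ≢ n → ¬ Factor (f m) (f n))

{-# OPTIONS --safe #-}
module Submission where

-- Let f₀ be a factor of αⱼ.  For k > j the word αₖ is a concatenation of copies of αⱼ₊₁ and of
-- its complement, each of which contains αⱼ; so every factor of αₖ longer than 2|αⱼ₊₁| covers
-- a whole block and therefore contains αⱼ, hence f₀.  In an antichain through f₀ all other
-- terms are thus of bounded length, and by the pigeonhole principle two of them coincide.

open import Defs
open import Data.Bool using (false; true; not)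
open import Data.Bool.Properties using (not-involutive)
open import Data.Nat using (ℕ; zero; suc; _+_; _≤_; _<_; _≤′_; ≤′-refl; ≤′-step; z≤n; s≤s)
open import Data.Nat.Properties
  using (≤-refl; ≤-reflexive; ≤-trans; m≤m+n; m≤n+m; <⇒≱; <⇒≢; ≮⇒≥; +-cancelˡ-<; +-monoˡ-≤;
         m≤m⊔n; m≤n⊔m; ≤⇒≤′; suc-injective; n<1+n; module ≤-Reasoning)
open import Data.List using (List; []; _∷_; _++_; map; length; lookup)
open import Data.List.Properties
  using (∷-injectiveˡ; ∷-injectiveʳ; map-++; map-∘; map-cong; map-id; length-map; length-++;
         ++-assoc; ++-identityʳ)
open import Data.List.Membership.Propositional using (_∈_)
open import Data.List.Membership.Propositional.Properties using (∈-++⁺ˡ; ∈-++⁺ʳ; ∈-map⁺)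
open import Data.List.Relation.Unary.Any using (here; there; index)
open import Data.List.Relation.Unary.Any.Properties using (lookup-index)
open import Data.Fin using (toℕ)
open import Data.Fin.Properties using (pigeonhole)
open import Data.Product using (∃; ∃₂; _×_; _,_; proj₁; proj₂)
open import Data.Sum using (_⊎_; inj₁; inj₂)
open import Data.Empty using (⊥-elim)
open import Function using (_∘_)
open import Relation.Binary.PropositionalEquality
  using (_≡_; refl; sym; trans; cong; cong₂; subst; module ≡-Reasoning)
open import Relation.Nullary using (¬_)

++-equidivisible : ∀ {A : Set} (x r b r′ : List A) → x ++ r ≡ b ++ r′ →
                   (∃ λ m → x ≡ b ++ m × r′ ≡ m ++ r) ⊎ (∃ λ m → b ≡ x ++ m × r ≡ m ++ r′)
++-equidivisible x       r []      r′ eq   = inj₁ (x , refl , sym eq)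
++-equidivisible []      r (c ∷ b) r′ eq   = inj₂ (c ∷ b , refl , eq)
++-equidivisible (a ∷ x) r (c ∷ b) r′ eq with refl ← ∷-injectiveˡ eq
  with ++-equidivisible x r b r′ (∷-injectiveʳ eq)
... | inj₁ (m , x≡bm , r′≡mr) = inj₁ (m , cong (a ∷_) x≡bm , r′≡mr)
... | inj₂ (m , b≡xm , r≡mr′) = inj₂ (m , cong (a ∷_) b≡xm , r≡mr′)

Factor-refl : ∀ u → Factor u u
Factor-refl u = [] , [] , sym (++-identityʳ u)

Factor-trans : ∀ {u v w} → Factor u v → Factor v w → Factor u w
Factor-trans {u} {v} {w} (c , d , v≡cud) (a , b , w≡avb) = a ++ c , d ++ b , (begin
  w                        ≡⟨ w≡avb ⟩
  a ++ v ++ b              ≡⟨ cong (λ t → a ++ t ++ b) v≡cud ⟩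
  a ++ (c ++ u ++ d) ++ b  ≡⟨ cong (a ++_) (++-assoc c (u ++ d) b) ⟩
  a ++ c ++ (u ++ d) ++ b  ≡⟨ cong (λ t → a ++ c ++ t) (++-assoc u d b) ⟩
  a ++ c ++ u ++ d ++ b    ≡⟨ sym (++-assoc a c (u ++ d ++ b)) ⟩
  (a ++ c) ++ u ++ d ++ b  ∎)
  where open ≡-Reasoning

Factor-length≤ : ∀ {u w} → Factor u w → length u ≤ length w
Factor-length≤ {u} (a , b , refl) = begin
  length u                    ≤⟨ m≤m+n (length u) (length b) ⟩
  length u + length b         ≡⟨ sym (length-++ u) ⟩
  length (u ++ b)             ≤⟨ m≤n+m (length (u ++ b)) (length a) ⟩
  length a + length (u ++ b)  ≡⟨ sym (length-++ a) ⟩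
  length (a ++ u ++ b)        ∎
  where open ≤-Reasoning

prefix-Factor : ∀ x y → Factor x (x ++ y)
prefix-Factor x y = [] , y , refl

suffix-Factor : ∀ x y → Factor y (x ++ y)
suffix-Factor x y = x , [] , cong (x ++_) (sym (++-identityʳ y))

Factor-++ˡ : ∀ {u x} y → Factor u x → Factor u (x ++ y)
Factor-++ˡ {x = x} y u≤x = Factor-trans u≤x (prefix-Factor x y)

Factor-++ʳ : ∀ {u y} x → Factor u y → Factor u (x ++ y)
Factor-++ʳ {y = y} x u≤y = Factor-trans u≤y (suffix-Factor x y)

Factor-power : ∀ w {n} → 1 ≤ n → Factor w (power w n)
Factor-power w {suc n} _ = prefix-Factor w (power w n)

complement-involutive : ∀ x → complement (complement x) ≡ x
complement-involutive x = trans (sym (map-∘ x)) (trans (map-cong not-involutive x) (map-id x))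

complement-power : ∀ w n → complement (power w n) ≡ power (complement w) n
complement-power w zero    = refl
complement-power w (suc n) =
  trans (map-++ not w (power w n)) (cong (complement w ++_) (complement-power w n))

data Blocks (Q : Word → Set) : Word → Set where
  []  : Blocks Q []
  _∷_ : ∀ {b w} → Q b → Blocks Q w → Blocks Q (b ++ w)

module _ {Q : Word → Set} where

  Blocks-++ : ∀ {x y} → Blocks Q x → Blocks Q y → Blocks Q (x ++ y)
  Blocks-++         []                 ys = ys
  Blocks-++ {y = y} (_∷_ {b} {w} q xs) ys =
    subst (Blocks Q) (sym (++-assoc b w y)) (q ∷ Blocks-++ xs ys)

  Blocks-power : ∀ {x} n → Blocks Q x → Blocks Q (power x n)
  Blocks-power zero    xs = []
  Blocks-power (suc n) xs = Blocks-++ xs (Blocks-power n xs)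

  Blocks-complement : (∀ {b} → Q b → Q (complement b)) → ∀ {x} → Blocks Q x → Blocks Q (complement x)
  Blocks-complement Q-compl []                 = []
  Blocks-complement Q-compl (_∷_ {b} {w} q xs) =
    subst (Blocks Q) (sym (map-++ not b w)) (Q-compl q ∷ Blocks-complement Q-compl xs)

Blocks-map : ∀ {P Q : Word → Set} → (∀ {b} → P b → Q b) → ∀ {x} → Blocks P x → Blocks Q x
Blocks-map P⇒Q []       = []
Blocks-map P⇒Q (p ∷ xs) = P⇒Q p ∷ Blocks-map P⇒Q xs

Tile : ℕ → Word → Word → Set
Tile L v b = length b ≤ L × Factor v b

module _ {L : ℕ} {v : Word} where

  long-prefix-of-Blocks : ∀ {z} → Blocks (Tile L v) z → ∀ {m y} → z ≡ m ++ y → L < length m →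
                          Factor v m
  long-prefix-of-Blocks [] {m} {y} []≡my L<m =
    ⊥-elim (<⇒≱ L<m (≤-trans (Factor-length≤ ([] , y , []≡my)) z≤n))
  long-prefix-of-Blocks (_∷_ {b} {z} (b≤L , v≤b) bs) {m} {y} bz≡my L<m
    with ++-equidivisible m y b z (sym bz≡my)
  ... | inj₁ (k , m≡bk , _) = subst (Factor v) (sym m≡bk) (Factor-++ˡ k v≤b)
  ... | inj₂ (k , b≡mk , _) =
    ⊥-elim (<⇒≱ L<m (≤-trans (Factor-length≤ m≤b) b≤L))
    where
      m≤b : Factor m b
      m≤b = subst (Factor m) (sym b≡mk) (prefix-Factor m k)

  long-factor-of-Blocks : ∀ {z} → Blocks (Tile L v) z → ∀ {w} → Factor w z → L + L < length w →
                          Factor v w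
  long-factor-of-Blocks [] w≤[] 2L<w = ⊥-elim (<⇒≱ 2L<w (≤-trans (Factor-length≤ w≤[]) z≤n))
  long-factor-of-Blocks (_∷_ {b} {z} (b≤L , v≤b) bs) {w} (x , y , bz≡xwy) 2L<w
    with ++-equidivisible x (w ++ y) b z (sym bz≡xwy)
  ... | inj₁ (m , _ , z≡mwy) = long-factor-of-Blocks bs (m , y , z≡mwy) 2L<w
  ... | inj₂ (m , b≡xm , wy≡mz) with ++-equidivisible w y m z wy≡mz
  ...   | inj₁ (m′ , w≡mm′ , z≡m′y) =
    subst (Factor v) (sym w≡mm′) (Factor-++ʳ m (long-prefix-of-Blocks bs z≡m′y L<m′))
    where
      m≤L : length m ≤ L
      m≤L = ≤-trans (Factor-length≤ (subst (Factor m) (sym b≡xm) (suffix-Factor x m))) b≤L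
      L<m′ : L < length m′
      L<m′ = +-cancelˡ-< L L (length m′) (begin-strict
        L + L                    <⟨ 2L<w ⟩
        length w                 ≡⟨ cong length w≡mm′ ⟩
        length (m ++ m′)         ≡⟨ length-++ m ⟩
        length m + length m′     ≤⟨ +-monoˡ-≤ (length m′) m≤L ⟩
        L + length m′            ∎)
        where open ≤-Reasoning
  ...   | inj₂ (m′ , m≡wm′ , _) = ⊥-elim (<⇒≱ 2L<w (≤-trans w≤L (m≤m+n L L)))
    where
      w≤b : Factor w b
      w≤b = Factor-trans (subst (Factor w) (sym m≡wm′) (prefix-Factor w m′))
                         (subst (Factor m) (sym b≡xm) (suffix-Factor x m))
      w≤L : length w ≤ L
      w≤L = ≤-trans (Factor-length≤ w≤b) b≤L

IsBlock : Word → Word → Set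
IsBlock B b = b ≡ B ⊎ b ≡ complement B

IsBlock-complement : ∀ {B b} → IsBlock B b → IsBlock B (complement b)
IsBlock-complement         (inj₁ refl) = inj₂ refl
IsBlock-complement {B = B} (inj₂ refl) = inj₁ (complement-involutive B)

alpha-Blocks : ∀ s {j k} → suc j ≤′ k → Blocks (IsBlock (alpha s (suc j))) (alpha s k)
alpha-Blocks s ≤′-refl            = subst (Blocks _) (++-identityʳ _) (inj₁ refl ∷ [])
alpha-Blocks s (≤′-step {k} j<k) =
  Blocks-++ (Blocks-power (s k) αₖ-blocks)
            (Blocks-power (s k) (Blocks-complement IsBlock-complement αₖ-blocks))
  where αₖ-blocks = alpha-Blocks s j<k

complement-alpha-suc : ∀ s i →
  complement (alpha s (suc i)) ≡ power (complement (alpha s i)) (s i) ++ power (alpha s i) (s i)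
complement-alpha-suc s i = begin
  complement (power α (s i) ++ power ᾱ (s i))
    ≡⟨ map-++ not (power α (s i)) _ ⟩
  complement (power α (s i)) ++ complement (power ᾱ (s i))
    ≡⟨ cong₂ _++_ (complement-power α (s i)) (complement-power ᾱ (s i)) ⟩
  power ᾱ (s i) ++ power (complement ᾱ) (s i)
    ≡⟨ cong (λ t → power ᾱ (s i) ++ power t (s i)) (complement-involutive α) ⟩
  power ᾱ (s i) ++ power α (s i)
    ∎
  where
    open ≡-Reasoning
    α = alpha s i
    ᾱ = complement α

module _ (s : ℕ → ℕ) (s-pos : ∀ k → 1 ≤ s k) where

  alpha-Factor-suc : ∀ i → Factor (alpha s i) (alpha s (suc i))
  alpha-Factor-suc i = Factor-++ˡ _ (Factor-power (alpha s i) (s-pos i))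

  alpha-Factor-complement-suc : ∀ i → Factor (alpha s i) (complement (alpha s (suc i)))
  alpha-Factor-complement-suc i = subst (Factor (alpha s i)) (sym (complement-alpha-suc s i))
    (Factor-++ʳ _ (Factor-power (alpha s i) (s-pos i)))

  alpha-mono : ∀ {i k} → i ≤′ k → Factor (alpha s i) (alpha s k)
  alpha-mono ≤′-refl        = Factor-refl _
  alpha-mono (≤′-step i≤k) = Factor-trans (alpha-mono i≤k) (alpha-Factor-suc _)

  IsBlock⇒Tile : ∀ j {b} → IsBlock (alpha s (suc j)) b → Tile (length (alpha s (suc j))) (alpha s j) b
  IsBlock⇒Tile j (inj₁ refl) = ≤-refl , alpha-Factor-suc j
  IsBlock⇒Tile j (inj₂ refl) =
    ≤-reflexive (length-map not (alpha s (suc j))) , alpha-Factor-complement-suc j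

  InL-recurrent : ∀ j {w} → InL s w → length (alpha s (suc j)) + length (alpha s (suc j)) < length w →
                  Factor (alpha s j) w
  InL-recurrent j (i , w≤αᵢ) = long-factor-of-Blocks
    (Blocks-map (IsBlock⇒Tile j) (alpha-Blocks s (≤⇒≤′ (m≤n⊔m i (suc j)))))
    (Factor-trans w≤αᵢ (alpha-mono (≤⇒≤′ (m≤m⊔n i (suc j)))))

wordsUpTo : ℕ → List Word
wordsUpTo zero    = [] ∷ []
wordsUpTo (suc n) = [] ∷ map (false ∷_) (wordsUpTo n) ++ map (true ∷_) (wordsUpTo n)

∈-wordsUpTo : ∀ {n w} → length w ≤ n → w ∈ wordsUpTo n
∈-wordsUpTo {zero}  {[]}        _         = here refl
∈-wordsUpTo {suc n} {[]}        _         = here refl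
∈-wordsUpTo {suc n} {false ∷ w} (s≤s w≤n) = there (∈-++⁺ˡ (∈-map⁺ (false ∷_) (∈-wordsUpTo w≤n)))
∈-wordsUpTo {suc n} {true ∷ w}  (s≤s w≤n) =
  there (∈-++⁺ʳ (map (false ∷_) (wordsUpTo n)) (∈-map⁺ (true ∷_) (∈-wordsUpTo w≤n)))

pigeonhole-list : ∀ {A : Set} (xs : List A) (f : ℕ → A) → (∀ n → f n ∈ xs) →
                  ∃₂ λ m n → m < n × f m ≡ f n
pigeonhole-list xs f f∈xs with pigeonhole (n<1+n (length xs)) (λ i → index (f∈xs (toℕ i)))
... | i , j , i<j , same = toℕ i , toℕ j , i<j ,
  trans (lookup-index (f∈xs (toℕ i)))
        (trans (cong (lookup xs) same) (sym (lookup-index (f∈xs (toℕ j)))))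

proposition2p3 : (s : ℕ → ℕ) → ((k : ℕ) → 1 ≤ s k) → ¬ InfiniteAntichain s
proposition2p3 s s-pos (f , f∈L , antichain) =
  no-repetition (pigeonhole-list (wordsUpTo (L + L)) (f ∘ suc) (λ n → ∈-wordsUpTo (bounded n)))
  where
    j = proj₁ (f∈L 0)
    L = length (alpha s (suc j))

    bounded : ∀ n → length (f (suc n)) ≤ L + L
    bounded n = ≮⇒≥ λ long → antichain 0 (suc n) (λ ())
      (Factor-trans (proj₂ (f∈L 0)) (InL-recurrent s s-pos j (f∈L (suc n)) long))

    no-repetition : ¬ ∃₂ λ m n → m < n × f (suc m) ≡ f (suc n)
    no-repetition (m , n , m<n , fm≡fn) =
      antichain (suc m) (suc n) (<⇒≢ m<n ∘ suc-injective)
                (subst (Factor (f (suc m))) fm≡fn (Factor-refl _))
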